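{- For $k\geq 4$, let $L_k=\operatorname{id}_{k-3}\ominus\cdots\ominus\operatorname{id}_{k-3}$ ($k-2$ summands) and $H_k=L_k\oplus L_k$. Then $H_k$ avoids every pattern in $B_k$. Consequently $N_k\geq 2(k-2)(k-3)+1$.
   Context: $\operatorname{id}_m=12\cdots m$; $\oplus$ denotes direct sum and $\ominus$ skew sum of permutations. For $k\ge3$, $p_k=12\cdots(k-2)\,k\,(k-1)$, $q_k=1\,k\,(k-1)\cdots 2$, $r_k=2\,1\,3\,4\cdots k$, $s_k=2\,3\cdots k\,1$, $B_k=\{p_k,q_k,r_k,s_k,p_k^c,q_k^c,r_k^c,s_k^c\}$ ($\cdot^c$ = complement). $N_k$ is the least integer such that $\operatorname{Av}_n(B_k)=\{\operatorname{id}_n,\operatorname{id}_n^r\}$ for all $n\geq N_k$, where $\operatorname{Av}_n(X)$ is the set of permutations of length $n$ avoiding (classically) every pattern of $X$. -}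

module Defs where

open import Data.Nat using (ℕ; zero; suc; _+_; _∸_; _<?_; _≤_)
open import Data.List using (List; []; _∷_; _++_; map; length; upTo; filter; reverse)
open import Data.List.Relation.Binary.Sublist.Propositional using (_⊆_)
open import Data.List.Relation.Binary.Permutation.Propositional using (_↭_)
open import Data.List.Relation.Unary.All using (All)
open import Data.Product using (Σ; _×_)
open import Data.Sum using (_⊎_)
open import Relation.Binary.PropositionalEquality using (_≡_)
open import Relation.Nullary using (¬_)

IsPerm : ℕ → List ℕ → Set
IsPerm n σ = σ ↭ map suc (upTo n)

idP : ℕ → List ℕ
idP m = map suc (upTo m)

compl : List ℕ → List ℕ
compl σ = map (λ x → suc (length σ) ∸ x) σ

_⊕_ : List ℕ → List ℕ → List ℕ
σ ⊕ τ = σ ++ map (_+ length σ) τ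

_⊖_ : List ℕ → List ℕ → List ℕ
σ ⊖ τ = map (_+ length τ) σ ++ τ

std : List ℕ → List ℕ
std τ = map (λ x → suc (length (filter (_<? x) τ))) τ

Contains : List ℕ → List ℕ → Set
Contains σ π = Σ (List ℕ) (λ τ → (τ ⊆ σ) × (std τ ≡ π))

Avoids : List ℕ → List (List ℕ) → Set
Avoids σ X = All (λ π → ¬ Contains σ π) X

p : ℕ → List ℕ
p k = idP (k ∸ 2) ++ (k ∷ (k ∸ 1) ∷ [])

-- q_k = 1 k (k-1) ⋯ 2
q : ℕ → List ℕ
q k = 1 ∷ map (λ i → k ∸ i) (upTo (k ∸ 1))

r : ℕ → List ℕ
r k = 2 ∷ 1 ∷ map (_+ 3) (upTo (k ∸ 2))

s : ℕ → List ℕ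
s k = map (_+ 2) (upTo (k ∸ 1)) ++ (1 ∷ [])

B : ℕ → List (List ℕ)
B k = p k ∷ q k ∷ r k ∷ s k ∷ compl (p k) ∷ compl (q k) ∷ compl (r k) ∷ compl (s k) ∷ []

AvIsMonotone : ℕ → ℕ → Set
AvIsMonotone k n = (σ : List ℕ) → IsPerm n σ →
  (Avoids σ (B k) → (σ ≡ idP n ⊎ σ ≡ reverse (idP n)))
  × ((σ ≡ idP n ⊎ σ ≡ reverse (idP n)) → Avoids σ (B k))

-- N satisfies the defining property of N_k (N_k is the least such N)
GoodBound : ℕ → ℕ → Set
GoodBound k N = (n : ℕ) → N ≤ n → AvIsMonotone k n

skewPow : ℕ → List ℕ → List ℕ
skewPow zero π = []
skewPow (suc zero) π = π
skewPow (suc (suc m)) π = π ⊖ skewPow (suc m) π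

L : ℕ → List ℕ
L k = skewPow (k ∸ 2) (idP (k ∸ 3))

H : ℕ → List ℕ
H k = L k ⊕ L k

{-# OPTIONS --safe #-}

-- Write m = k − 3 and M = (m + 1) m for the length of L_k. An entry of H_k = L_k ⊕ L_k is determined by its
-- copy c ∈ {0, 1} of L_k, its block d ≤ m (an increasing run of length m) inside that copy and its offset e < m
-- inside the block, and its value is 1 + cM + dm + e. Reading H_k from left to right, copies increase, blocks
-- decrease and offsets increase. So a descent of H_k stays inside one copy and goes to a lower block, while an
-- ascent inside one copy stays inside one block: decreasing subsequences of H_k have length at most m + 1, and
-- increasing subsequences inside one copy have length at most m.
-- Now q_k and the complements of p_k, r_k, s_k contain a decreasing sequence of length k − 1 = m + 2, while p_k,
-- r_k, s_k and q_k^c contain an increasing run of length at least m + 1 that their remaining entries (a later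
-- descent above it, an earlier descent below it, a later entry below it, an earlier entry above it) force into
-- a single copy. Finally H_k is a permutation of length 2(k − 2)(k − 3) that avoids B_k but is neither id nor its
-- reverse, so N_k exceeds its length.
module Submission where

open import Defs
open import Data.Nat using (ℕ; zero; suc; _+_; _*_; _∸_; _≤_; _<_; _>_; z≤n; s≤s)
open import Data.Nat.Properties
open import Data.List using (List; []; _∷_; _++_; [_]; map; length; upTo; filter; reverse)
open import Data.List.Properties
  using (∷-injective; map-++; map-∘; map-cong; map-id; length-map; length-++; length-upTo; ++-identityʳ; ++-assoc;
         upTo-∷ʳ; reverse-map; reverse-upTo)
open import Data.List.Relation.Unary.All as All using (All; []; _∷_)
import Data.List.Relation.Unary.All.Properties as All
open import Data.List.Relation.Unary.AllPairs as AllPairs using (AllPairs; []; _∷_)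
import Data.List.Relation.Unary.AllPairs.Properties as AllPairs
open import Data.List.Relation.Binary.Sublist.Propositional using (_⊆_; []; _∷_; _∷ʳ_; ⊆-refl; ⊆-trans)
import Data.List.Relation.Binary.Sublist.Propositional.Properties as Sublist
open import Data.List.Relation.Binary.Sublist.Heterogeneous.Properties using (length-mono-≤; ⊆-filter-Sublist)
open import Data.List.Relation.Binary.Permutation.Propositional using (↭-refl; module PermutationReasoning)
import Data.List.Relation.Binary.Permutation.Propositional.Properties as ↭
open import Data.Product using (∃; ∃₂; _×_; _,_; proj₁; proj₂)
open import Data.Sum using (_⊎_; inj₁; inj₂; [_,_]′)
open import Function using (_∘_)
open import Relation.Binary.Definitions using (tri<; tri≈; tri>)
open import Relation.Binary.PropositionalEquality
  using (_≡_; _≢_; refl; sym; trans; cong; cong₂; subst; subst₂; module ≡-Reasoning)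
open import Relation.Nullary using (¬_; yes; no; contradiction)

private variable
  A C : Set
  R : A → A → Set

⊆-map⁻ : ∀ {ys} (f : A → C) (xs : List A) → ys ⊆ map f xs → ∃ λ zs → zs ⊆ xs × ys ≡ map f zs
⊆-map⁻ f [] [] = [] , [] , refl
⊆-map⁻ f (x ∷ xs) (_ ∷ʳ ys⊆) with ⊆-map⁻ f xs ys⊆
... | zs , zs⊆ , refl = zs , x ∷ʳ zs⊆ , refl
⊆-map⁻ f (x ∷ xs) (refl ∷ ys⊆) with ⊆-map⁻ f xs ys⊆
... | zs , zs⊆ , refl = x ∷ zs , refl ∷ zs⊆ , refl

map-++⁻ : ∀ (f : A → C) xs {ys} zs → map f zs ≡ xs ++ ys →
          ∃₂ λ zs₁ zs₂ → zs ≡ zs₁ ++ zs₂ × map f zs₁ ≡ xs × map f zs₂ ≡ ys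
map-++⁻ f [] zs eq = [] , zs , refl , refl , eq
map-++⁻ f (x ∷ xs) (z ∷ zs) eq with ∷-injective eq
... | refl , eq′ with map-++⁻ f xs zs eq′
...   | zs₁ , zs₂ , refl , refl , refl = z ∷ zs₁ , zs₂ , refl , refl , refl

AllPairs-resp-⊆ : ∀ {xs ys} → xs ⊆ ys → AllPairs R ys → AllPairs R xs
AllPairs-resp-⊆ [] [] = []
AllPairs-resp-⊆ (_ ∷ʳ xs⊆) (_ ∷ rys) = AllPairs-resp-⊆ xs⊆ rys
AllPairs-resp-⊆ (refl ∷ xs⊆) (rx ∷ rys) = Sublist.All-resp-⊆ xs⊆ rx ∷ AllPairs-resp-⊆ xs⊆ rys

AllPairs-++⁻ : ∀ xs {ys} → AllPairs R (xs ++ ys) →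
               AllPairs R xs × AllPairs R ys × All (λ x → All (R x) ys) xs
AllPairs-++⁻ [] rys = [] , rys , []
AllPairs-++⁻ (x ∷ xs) (rx ∷ rxys) with AllPairs-++⁻ xs rxys
... | rxs , rys , cross = All.++⁻ˡ xs rx ∷ rxs , rys , All.++⁻ʳ xs rx ∷ cross

AllPairs-zipWithAll : ∀ {P : A → Set} {S : A → A → Set} → (∀ {x y} → P x → P y → R x y → S x y) →
                      ∀ {xs} → All P xs → AllPairs R xs → AllPairs S xs
AllPairs-zipWithAll f [] [] = []
AllPairs-zipWithAll f (px ∷ pxs) (rx ∷ rxs) =
  All.zipWith (λ (py , rxy) → f px py rxy) (pxs , rx) ∷ AllPairs-zipWithAll f pxs rxs

decreasing⇒length≤ : ∀ {U} ns → AllPairs _>_ ns → All (_< U) ns → length ns ≤ U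
decreasing⇒length≤ [] _ _ = z≤n
decreasing⇒length≤ (n ∷ ns) (n>ns ∷ dec) (n<U ∷ _) =
  ≤-trans (s≤s (decreasing⇒length≤ ns dec n>ns)) n<U

increasing⇒length≤ : ∀ {lo U} ns → AllPairs _<_ ns → All (lo ≤_) ns → All (_< U) ns →
                     length ns ≤ U ∸ lo
increasing⇒length≤ [] _ _ _ = z≤n
increasing⇒length≤ {lo} {U} (n ∷ ns) (n<ns ∷ inc) (lo≤n ∷ _) (n<U ∷ ns<U) = begin
  suc (length ns)  ≤⟨ s≤s (increasing⇒length≤ ns inc n<ns ns<U) ⟩
  suc (U ∸ suc n)  ≡⟨ +-∸-assoc 1 n<U ⟨
  U ∸ n            ≤⟨ ∸-monoʳ-≤ U lo≤n ⟩
  U ∸ lo           ∎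
  where open ≤-Reasoning

upTo-increasing : ∀ n → AllPairs _<_ (upTo n)
upTo-increasing n = AllPairs.applyUpTo⁺₁ (λ i → i) n (λ i<j _ → i<j)

compl-increasing : ∀ {n xs} → AllPairs _<_ xs → All (_≤ n) xs → AllPairs _>_ (map (suc n ∸_) xs)
compl-increasing inc bounded =
  AllPairs.map⁺ (AllPairs-zipWithAll (λ _ y≤n x<y → ∸-monoʳ-< x<y (m≤n⇒m≤1+n y≤n)) bounded inc)

compl-decreasing : ∀ {n xs} → AllPairs _>_ xs → All (_≤ n) xs → AllPairs _<_ (map (suc n ∸_) xs)
compl-decreasing dec bounded =
  AllPairs.map⁺ (AllPairs-zipWithAll (λ x≤n _ x>y → ∸-monoʳ-< x>y (m≤n⇒m≤1+n x≤n)) bounded dec)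

compl-above : ∀ {n a xs} → All (a <_) xs → All (_≤ n) xs → All (_< suc n ∸ a) (map (suc n ∸_) xs)
compl-above above bounded =
  All.map⁺ (All.zipWith (λ (a<x , x≤n) → ∸-monoʳ-< a<x (m≤n⇒m≤1+n x≤n)) (above , bounded))

length-map-upTo : ∀ (f : ℕ → ℕ) n → length (map f (upTo n)) ≡ n
length-map-upTo f n = trans (length-map f (upTo n)) (length-upTo n)

map-upTo-increasing : ∀ {f : ℕ → ℕ} n → (∀ {i j} → i < j → f i < f j) → AllPairs _<_ (map f (upTo n))
map-upTo-increasing n f-mono = AllPairs.map⁺ (AllPairs.map f-mono (upTo-increasing n))

rank : List ℕ → ℕ → ℕ
rank τ x = suc (length (filter (_<? x) τ))

rank-mono-≤ : ∀ τ {x y} → x ≤ y → rank τ x ≤ rank τ y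
rank-mono-≤ τ {x} {y} x≤y =
  s≤s (length-mono-≤ (⊆-filter-Sublist (_<? x) (_<? y) (λ { refl z<x → <-≤-trans z<x x≤y })
                                        (⊆-refl {x = τ})))

rank-reflects-< : ∀ τ {x y} → rank τ x < rank τ y → x < y
rank-reflects-< τ {x} {y} lt with x <? y
... | yes x<y = x<y
... | no x≮y = contradiction (rank-mono-≤ τ (≮⇒≥ x≮y)) (<⇒≱ lt)

*+-<-lex : ∀ {U a b r s} → r < U → s < U → a * U + r < b * U + s → a < b ⊎ (a ≡ b × r < s)
*+-<-lex {U} {a} {b} {r} {s} r<U s<U lt with <-cmp a b
... | tri< a<b _ _ = inj₁ a<b
... | tri≈ _ refl _ = inj₂ (refl , +-cancelˡ-< (a * U) r s lt)
... | tri> _ _ b<a = contradiction lt (<⇒≯ (begin-strict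
  b * U + s  <⟨ +-monoʳ-< (b * U) s<U ⟩
  b * U + U  ≡⟨ +-comm (b * U) U ⟩
  suc b * U  ≤⟨ *-monoˡ-≤ U b<a ⟩
  a * U      ≤⟨ m≤m+n (a * U) r ⟩
  a * U + r  ∎))
  where open ≤-Reasoning

upTo-+ : ∀ a b → upTo (a + b) ≡ upTo a ++ map (a +_) (upTo b)
upTo-+ a zero = trans (cong upTo (+-identityʳ a)) (sym (++-identityʳ (upTo a)))
upTo-+ a (suc b) = begin
  upTo (a + suc b)                                   ≡⟨ cong upTo (+-suc a b) ⟩
  upTo (suc (a + b))                                 ≡⟨ upTo-∷ʳ (a + b) ⟨
  upTo (a + b) ++ [ a + b ]                          ≡⟨ cong (_++ [ a + b ]) (upTo-+ a b) ⟩
  (upTo a ++ map (a +_) (upTo b)) ++ [ a + b ]       ≡⟨ ++-assoc (upTo a) _ _ ⟩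
  upTo a ++ (map (a +_) (upTo b) ++ map (a +_) [ b ]) ≡⟨ cong (upTo a ++_) (map-++ (a +_) (upTo b) [ b ]) ⟨
  upTo a ++ map (a +_) (upTo b ++ [ b ])             ≡⟨ cong (λ xs → upTo a ++ map (a +_) xs) (upTo-∷ʳ b) ⟩
  upTo a ++ map (a +_) (upTo (suc b))                ∎
  where open ≡-Reasoning

idP-+ : ∀ a b → idP (a + b) ≡ idP a ++ map (_+ a) (idP b)
idP-+ a b = begin
  map suc (upTo (a + b))                              ≡⟨ cong (map suc) (upTo-+ a b) ⟩
  map suc (upTo a ++ map (a +_) (upTo b))             ≡⟨ map-++ suc (upTo a) _ ⟩
  idP a ++ map suc (map (a +_) (upTo b))              ≡⟨ cong (idP a ++_) (map-∘ (upTo b)) ⟨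
  idP a ++ map (suc ∘ (a +_)) (upTo b)                ≡⟨ cong (idP a ++_) (map-cong (cong suc ∘ +-comm a) _) ⟩
  idP a ++ map ((_+ a) ∘ suc) (upTo b)                ≡⟨ cong (idP a ++_) (map-∘ (upTo b)) ⟩
  idP a ++ map (_+ a) (idP b)                         ∎
  where open ≡-Reasoning

IsPerm-length : ∀ {n σ} → IsPerm n σ → length σ ≡ n
IsPerm-length {n} σ↭ = trans (↭.↭-length σ↭) (trans (length-map suc (upTo n)) (length-upTo n))

⊕-isPerm : ∀ {a b σ τ} → IsPerm a σ → IsPerm b τ → IsPerm (a + b) (σ ⊕ τ)
⊕-isPerm {a} {b} {σ} {τ} σ↭ τ↭ = begin
  σ ++ map (_+ length σ) τ    ≡⟨ cong (λ n → σ ++ map (_+ n) τ) (IsPerm-length σ↭) ⟩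
  σ ++ map (_+ a) τ           ↭⟨ ↭.++⁺ σ↭ (↭.map⁺ (_+ a) τ↭) ⟩
  idP a ++ map (_+ a) (idP b) ≡⟨ idP-+ a b ⟨
  idP (a + b)                 ∎
  where open PermutationReasoning

⊖-isPerm : ∀ {a b σ τ} → IsPerm a σ → IsPerm b τ → IsPerm (a + b) (σ ⊖ τ)
⊖-isPerm {a} {b} {σ} {τ} σ↭ τ↭ = begin
  map (_+ length τ) σ ++ τ    ≡⟨ cong (λ n → map (_+ n) σ ++ τ) (IsPerm-length τ↭) ⟩
  map (_+ b) σ ++ τ           ↭⟨ ↭.++-comm (map (_+ b) σ) τ ⟩
  τ ++ map (_+ b) σ           ↭⟨ ↭.++⁺ τ↭ (↭.map⁺ (_+ b) σ↭) ⟩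
  idP b ++ map (_+ b) (idP a) ≡⟨ idP-+ b a ⟨
  idP (b + a)                 ≡⟨ cong idP (+-comm b a) ⟩
  idP (a + b)                 ∎
  where open PermutationReasoning

skewPow-isPerm : ∀ j {n π} → IsPerm n π → IsPerm (j * n) (skewPow j π)
skewPow-isPerm zero π↭ = ↭-refl
skewPow-isPerm (suc zero) {n} {π} π↭ = subst (λ i → IsPerm i π) (sym (+-identityʳ n)) π↭
skewPow-isPerm (suc (suc j)) π↭ = ⊖-isPerm π↭ (skewPow-isPerm (suc j) π↭)

H-isPerm : ∀ k → IsPerm (2 * (k ∸ 2) * (k ∸ 3)) (H k)
H-isPerm k = subst (λ n → IsPerm n (H k)) (sym 2ab≡ab+ab) (⊕-isPerm L↭ L↭)
  where
  ab = (k ∸ 2) * (k ∸ 3)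
  2ab≡ab+ab : 2 * (k ∸ 2) * (k ∸ 3) ≡ ab + ab
  2ab≡ab+ab = trans (*-assoc 2 (k ∸ 2) (k ∸ 3)) (cong (ab +_) (+-identityʳ ab))
  L↭ : IsPerm ((k ∸ 2) * (k ∸ 3)) (L k)
  L↭ = skewPow-isPerm (k ∸ 2) ↭-refl

reverse-idP-decreasing : ∀ n → AllPairs _>_ (reverse (idP n))
reverse-idP-decreasing n =
  subst (AllPairs _>_) (trans (cong (map suc) (sym (reverse-upTo n))) (reverse-map suc (upTo n)))
  (AllPairs.map⁺ (AllPairs.map s≤s (AllPairs.applyDownFrom⁺₁ (λ i → i) n (λ j<i _ → j<i))))

record Cell : Set where
  constructor cell
  field
    copy block offset : ℕ

open Cell

module Cells (m : ℕ) where

  M : ℕ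
  M = suc m * m

  value : Cell → ℕ
  value (cell c d e) = suc (c * M + (d * m + e))

  InRange : Cell → Set
  InRange u = copy u ≤ 1 × block u ≤ m × offset u < m

  data _≺_ (u v : Cell) : Set where
    copy<   : copy u < copy v → u ≺ v
    block>  : copy u ≡ copy v → block v < block u → u ≺ v
    offset< : copy u ≡ copy v → block u ≡ block v → offset u < offset v → u ≺ v

  data Lex (u v : Cell) : Set where
    copy<   : copy u < copy v → Lex u v
    block<  : copy u ≡ copy v → block u < block v → Lex u v
    offset< : copy u ≡ copy v → block u ≡ block v → offset u < offset v → Lex u v

  inCopy-< : ∀ {d e} → d ≤ m → e < m → d * m + e < M
  inCopy-< {d} {e} d≤m e<m = begin-strict
    d * m + e  <⟨ +-monoʳ-< (d * m) e<m ⟩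
    d * m + m  ≤⟨ +-monoˡ-≤ m (*-monoˡ-≤ m d≤m) ⟩
    m * m + m  ≡⟨ +-comm (m * m) m ⟩
    M          ∎
    where open ≤-Reasoning

  value-<⇒Lex : ∀ {u v} → InRange u → InRange v → value u < value v → Lex u v
  value-<⇒Lex {cell c d e} {cell c′ d′ e′} (_ , d≤m , e<m) (_ , d′≤m , e′<m) (s≤s lt)
    with *+-<-lex (inCopy-< d≤m e<m) (inCopy-< d′≤m e′<m) lt
  ... | inj₁ c<c′ = copy< c<c′
  ... | inj₂ (refl , lt′) with *+-<-lex e<m e′<m lt′
  ...   | inj₁ d<d′ = block< refl d<d′
  ...   | inj₂ (refl , e<e′) = offset< refl refl e<e′

  descent⇒sameCopy : ∀ {u v} → u ≺ v → Lex v u → copy u ≡ copy v × block v < block u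
  descent⇒sameCopy (block> c≡ d>) _ = c≡ , d>
  descent⇒sameCopy (copy< c<) (copy< c>) = contradiction c> (<-asym c<)
  descent⇒sameCopy (copy< c<) (block< c≡ _) = contradiction c< (<-irrefl (sym c≡))
  descent⇒sameCopy (copy< c<) (offset< c≡ _ _) = contradiction c< (<-irrefl (sym c≡))
  descent⇒sameCopy (offset< c≡ _ _) (copy< c>) = contradiction c> (<-irrefl (sym c≡))
  descent⇒sameCopy (offset< _ d≡ _) (block< _ d<) = contradiction d< (<-irrefl (sym d≡))
  descent⇒sameCopy (offset< _ _ e<) (offset< _ _ e>) = contradiction e> (<-asym e<)

  ascent⇒sameBlock : ∀ {u v} → u ≺ v → Lex u v → copy u ≡ copy v →
                     block u ≡ block v × offset u < offset v
  ascent⇒sameBlock (offset< _ d≡ e<) _ _ = d≡ , e<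
  ascent⇒sameBlock (copy< c<) _ c≡ = contradiction c< (<-irrefl c≡)
  ascent⇒sameBlock (block> _ d>) (copy< c<) c≡ = contradiction c< (<-irrefl c≡)
  ascent⇒sameBlock (block> _ d>) (block< _ d<) _ = contradiction d< (<-asym d>)
  ascent⇒sameBlock (block> _ d>) (offset< _ d≡ _) _ = contradiction d> (<-irrefl (sym d≡))

  Lex⇒copy≤ : ∀ {u v} → Lex u v → copy u ≤ copy v
  Lex⇒copy≤ (copy< c<) = <⇒≤ c<
  Lex⇒copy≤ (block< c≡ _) = ≤-reflexive c≡
  Lex⇒copy≤ (offset< c≡ _ _) = ≤-reflexive c≡

  ≺-sameCopy⇒block≥ : ∀ {u v} → u ≺ v → copy u ≡ copy v → block v ≤ block u
  ≺-sameCopy⇒block≥ (copy< c<) c≡ = contradiction c< (<-irrefl c≡)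
  ≺-sameCopy⇒block≥ (block> _ d>) _ = <⇒≤ d>
  ≺-sameCopy⇒block≥ (offset< _ d≡ _) _ = ≤-reflexive (sym d≡)

  Lex-sameCopy⇒block≤ : ∀ {u v} → Lex u v → copy u ≡ copy v → block u ≤ block v
  Lex-sameCopy⇒block≤ (copy< c<) c≡ = contradiction c< (<-irrefl c≡)
  Lex-sameCopy⇒block≤ (block< _ d<) _ = <⇒≤ d<
  Lex-sameCopy⇒block≤ (offset< _ d≡ _) _ = ≤-reflexive d≡

  earlier-below-descent⇒copy< : ∀ {x a b} → x ≺ a → Lex x b → a ≺ b → Lex b a → copy x < copy b
  earlier-below-descent⇒copy< {x} {a} {b} x≺a x<b a≺b b<a with m≤n⇒m<n∨m≡n (Lex⇒copy≤ x<b)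
  ... | inj₁ cx<cb = cx<cb
  ... | inj₂ cx≡cb = contradiction (begin
    block a  ≤⟨ ≺-sameCopy⇒block≥ x≺a (trans cx≡cb (sym ca≡cb)) ⟩
    block x  ≤⟨ Lex-sameCopy⇒block≤ x<b cx≡cb ⟩
    block b  ∎) (<⇒≱ db<da)
    where
    open ≤-Reasoning
    ca≡cb = proj₁ (descent⇒sameCopy a≺b b<a)
    db<da = proj₂ (descent⇒sameCopy a≺b b<a)

  later-above-descent⇒copy> : ∀ {a b y} → a ≺ b → Lex b a → b ≺ y → Lex a y → copy a < copy y
  later-above-descent⇒copy> {a} {b} {y} a≺b b<a b≺y a<y with m≤n⇒m<n∨m≡n (Lex⇒copy≤ a<y)
  ... | inj₁ ca<cy = ca<cy
  ... | inj₂ ca≡cy = contradiction (begin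
    block a  ≤⟨ Lex-sameCopy⇒block≤ a<y ca≡cy ⟩
    block y  ≤⟨ ≺-sameCopy⇒block≥ b≺y (trans (sym ca≡cb) ca≡cy) ⟩
    block b  ∎) (<⇒≱ db<da)
    where
    open ≤-Reasoning
    ca≡cb = proj₁ (descent⇒sameCopy a≺b b<a)
    db<da = proj₂ (descent⇒sameCopy a≺b b<a)

  blockCells : ℕ → ℕ → List Cell
  blockCells c d = map (cell c d) (upTo m)

  copyCells : ℕ → ℕ → List Cell
  copyCells c zero    = blockCells c zero
  copyCells c (suc d) = blockCells c (suc d) ++ copyCells c d

  cells : List Cell
  cells = copyCells 0 m ++ copyCells 1 m

  copyCells-bounded : ∀ c d → All (λ u → copy u ≡ c × block u ≤ d × offset u < m) (copyCells c d)
  copyCells-bounded c zero = All.map⁺ (All.map (λ e<m → refl , z≤n , e<m) (All.all-upTo m))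
  copyCells-bounded c (suc d) = All.++⁺
    (All.map⁺ (All.map (λ e<m → refl , ≤-refl , e<m) (All.all-upTo m)))
    (All.map (λ (c≡ , d′≤d , e<m) → c≡ , m≤n⇒m≤1+n d′≤d , e<m) (copyCells-bounded c d))

  blockCells-sorted : ∀ c d → AllPairs _≺_ (blockCells c d)
  blockCells-sorted c d = AllPairs.map⁺ (AllPairs.map (offset< refl refl) (upTo-increasing m))

  copyCells-sorted : ∀ c d → AllPairs _≺_ (copyCells c d)
  copyCells-sorted c zero = blockCells-sorted c zero
  copyCells-sorted c (suc d) = AllPairs.++⁺ (blockCells-sorted c (suc d)) (copyCells-sorted c d)
    (All.map⁺ (All.universal (λ _ → All.map (λ (c≡ , d′≤d , _) → block> (sym c≡) (s≤s d′≤d))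
                                            (copyCells-bounded c d))
                             (upTo m)))

  cells-sorted : AllPairs _≺_ cells
  cells-sorted = AllPairs.++⁺ (copyCells-sorted 0 m) (copyCells-sorted 1 m)
    (All.map (λ (c≡0 , _) → All.map (λ (c≡1 , _) → copy< (subst₂ _<_ (sym c≡0) (sym c≡1) (s≤s z≤n)))
                                    (copyCells-bounded 1 m))
             (copyCells-bounded 0 m))

  copyCells-inRange : ∀ {c} → c ≤ 1 → All InRange (copyCells c m)
  copyCells-inRange c≤1 =
    All.map (λ (c≡ , d≤m , e<m) → subst (_≤ 1) (sym c≡) c≤1 , d≤m , e<m) (copyCells-bounded _ m)

  cells-inRange : All InRange cells
  cells-inRange = All.++⁺ (copyCells-inRange z≤n) (copyCells-inRange (s≤s z≤n))

  blockCells-values : ∀ c d → map value (blockCells c d) ≡ map (c * M +_) (map (_+ d * m) (idP m))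
  blockCells-values c d = begin
    map value (map (cell c d) (upTo m))         ≡⟨ map-∘ (upTo m) ⟨
    map (value ∘ cell c d) (upTo m)             ≡⟨ map-cong shift (upTo m) ⟩
    map ((c * M +_) ∘ (_+ d * m) ∘ suc) (upTo m) ≡⟨ map-∘ (upTo m) ⟩
    map (c * M +_) (map ((_+ d * m) ∘ suc) (upTo m)) ≡⟨ cong (map (c * M +_)) (map-∘ (upTo m)) ⟩
    map (c * M +_) (map (_+ d * m) (idP m))     ∎
    where
    open ≡-Reasoning
    shift : ∀ e → suc (c * M + (d * m + e)) ≡ c * M + (suc e + d * m)
    shift e = trans (sym (+-suc (c * M) (d * m + e))) (cong (λ x → c * M + suc x) (+-comm (d * m) e))

  length-skewPow : ∀ j → length (skewPow j (idP m)) ≡ j * m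
  length-skewPow j = IsPerm-length (skewPow-isPerm j ↭-refl)

  copyCells-values : ∀ c d → map value (copyCells c d) ≡ map (c * M +_) (skewPow (suc d) (idP m))
  copyCells-values c zero = trans (blockCells-values c zero)
    (cong (map (c * M +_)) (trans (map-cong +-identityʳ (idP m)) (map-id (idP m))))
  copyCells-values c (suc d) = begin
    map value (blockCells c (suc d) ++ copyCells c d)
      ≡⟨ map-++ value (blockCells c (suc d)) _ ⟩
    map value (blockCells c (suc d)) ++ map value (copyCells c d)
      ≡⟨ cong₂ _++_ (blockCells-values c (suc d)) (copyCells-values c d) ⟩
    map (c * M +_) (map (_+ suc d * m) (idP m)) ++ map (c * M +_) S
      ≡⟨ map-++ (c * M +_) _ S ⟨
    map (c * M +_) (map (_+ suc d * m) (idP m) ++ S)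
      ≡⟨ cong (λ n → map (c * M +_) (map (_+ n) (idP m) ++ S)) (length-skewPow (suc d)) ⟨
    map (c * M +_) (skewPow (suc (suc d)) (idP m))
      ∎
    where
    open ≡-Reasoning
    S = skewPow (suc d) (idP m)

  H-cells : H (3 + m) ≡ map value cells
  H-cells = begin
    L′ ++ map (_+ length L′) L′
      ≡⟨ cong₂ _++_ (map-id L′) second ⟨
    map (0 * M +_) L′ ++ map (1 * M +_) L′
      ≡⟨ cong₂ _++_ (copyCells-values 0 m) (copyCells-values 1 m) ⟨
    map value (copyCells 0 m) ++ map value (copyCells 1 m)
      ≡⟨ map-++ value (copyCells 0 m) _ ⟨
    map value cells
      ∎
    where
    open ≡-Reasoning
    L′ = L (3 + m)
    second : map (1 * M +_) L′ ≡ map (_+ length L′) L′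
    second = map-cong (λ x → trans (cong (_+ x) (*-identityˡ M))
                                   (trans (+-comm M x) (cong (x +_) (sym (length-skewPow (suc m)))))) L′

  ⊆cells⇒sorted : ∀ {ρ} → ρ ⊆ cells → AllPairs _≺_ ρ
  ⊆cells⇒sorted ρ⊆ = AllPairs-resp-⊆ ρ⊆ cells-sorted

  ⊆cells⇒inRange : ∀ {ρ} → ρ ⊆ cells → All InRange ρ
  ⊆cells⇒inRange ρ⊆ = Sublist.All-resp-⊆ ρ⊆ cells-inRange

  decreasing⇒length≤1+m : ∀ {ρ} → ρ ⊆ cells → AllPairs (λ u v → value u > value v) ρ →
                          length ρ ≤ suc m
  decreasing⇒length≤1+m {ρ} ρ⊆ dec = subst (_≤ suc m) (length-map block ρ)
    (decreasing⇒length≤ (map block ρ) (AllPairs.map⁺ blocks-decreasing)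
      (All.map⁺ (All.map (λ (_ , d≤m , _) → s≤s d≤m) (⊆cells⇒inRange ρ⊆))))
    where
    blocks-decreasing : AllPairs (λ u v → block u > block v) ρ
    blocks-decreasing = AllPairs-zipWithAll
      (λ ru rv (u≺v , u>v) → proj₂ (descent⇒sameCopy u≺v (value-<⇒Lex rv ru u>v)))
      (⊆cells⇒inRange ρ⊆) (AllPairs.zip (⊆cells⇒sorted ρ⊆ , dec))

  sameCopy-increasing⇒length≤m : ∀ {c ρ} → ρ ⊆ cells → All (λ u → copy u ≡ c) ρ →
                                 AllPairs (λ u v → value u < value v) ρ → length ρ ≤ m
  sameCopy-increasing⇒length≤m {c} {ρ} ρ⊆ copies inc = subst (_≤ m) (length-map offset ρ)
    (increasing⇒length≤ (map offset ρ) (AllPairs.map⁺ offsets-increasing)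
      (All.map⁺ (All.universal (λ _ → z≤n) ρ))
      (All.map⁺ (All.map (λ (_ , _ , e<m) → e<m) (⊆cells⇒inRange ρ⊆))))
    where
    offsets-increasing : AllPairs (λ u v → offset u < offset v) ρ
    offsets-increasing = AllPairs-zipWithAll
      (λ (ru , cu) (rv , cv) (u≺v , u<v) →
         proj₂ (ascent⇒sameBlock u≺v (value-<⇒Lex ru rv u<v) (trans cu (sym cv))))
      (All.zip (⊆cells⇒inRange ρ⊆ , copies)) (AllPairs.zip (⊆cells⇒sorted ρ⊆ , inc))

  below-descent⇒firstCopy : ∀ {ρ a b} → ρ ++ a ∷ b ∷ [] ⊆ cells → value b < value a →
                            All (λ x → value x < value b) ρ → All (λ x → copy x ≡ 0) ρ
  below-descent⇒firstCopy {ρ} ρab⊆ b<a below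
    with AllPairs-++⁻ ρ (⊆cells⇒sorted ρab⊆) | All.++⁻ ρ (⊆cells⇒inRange ρab⊆)
  ... | _ , (a≺b ∷ []) ∷ _ , before | inRangeρ , ra ∷ rb ∷ [] =
    All.zipWith (λ { ((rx , x≺a ∷ _) , x<b) → n<1⇒n≡0 (<-≤-trans
        (earlier-below-descent⇒copy< x≺a (value-<⇒Lex rx rb x<b) a≺b (value-<⇒Lex rb ra b<a)) (proj₁ rb)) })
      (All.zip (inRangeρ , before) , below)

  above-descent⇒secondCopy : ∀ {a b ρ} → a ∷ b ∷ ρ ⊆ cells → value b < value a →
                             All (λ y → value a < value y) ρ → All (λ y → copy y ≡ 1) ρ
  above-descent⇒secondCopy abρ⊆ b<a above
    with ⊆cells⇒sorted abρ⊆ | ⊆cells⇒inRange abρ⊆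
  ... | (a≺b ∷ _) ∷ b≺ρ ∷ _ | ra ∷ rb ∷ inRangeρ =
    All.zipWith (λ ((ry , b≺y) , a<y) → ≤-antisym (proj₁ ry) (≤-trans (s≤s z≤n)
        (later-above-descent⇒copy> a≺b (value-<⇒Lex rb ra b<a) b≺y (value-<⇒Lex ra ry a<y))))
      (All.zip (inRangeρ , b≺ρ) , above)

  above-later⇒sameCopy : ∀ {ρ z} → ρ ++ [ z ] ⊆ cells → All (λ y → value z < value y) ρ →
                         All (λ y → copy y ≡ copy z) ρ
  above-later⇒sameCopy {ρ} ρz⊆ above
    with AllPairs-++⁻ ρ (⊆cells⇒sorted ρz⊆) | All.++⁻ ρ (⊆cells⇒inRange ρz⊆)
  ... | _ , _ , before | inRangeρ , rz ∷ [] =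
    All.zipWith (λ { ((ry , y≺z ∷ []) , z<y) → proj₁ (descent⇒sameCopy y≺z (value-<⇒Lex rz ry z<y)) })
      (All.zip (inRangeρ , before) , above)

  below-earlier⇒sameCopy : ∀ {z ρ} → z ∷ ρ ⊆ cells → All (λ y → value y < value z) ρ →
                           All (λ y → copy y ≡ copy z) ρ
  below-earlier⇒sameCopy zρ⊆ below with ⊆cells⇒sorted zρ⊆ | ⊆cells⇒inRange zρ⊆
  ... | z≺ρ ∷ _ | rz ∷ inRangeρ =
    All.zipWith (λ ((ry , z≺y) , y<z) → sym (proj₁ (descent⇒sameCopy z≺y (value-<⇒Lex ry rz y<z))))
      (All.zip (inRangeρ , z≺ρ) , below)

module Avoidance (m : ℕ) where
  open Cells m

  record Occurrence (π : List ℕ) : Set where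
    constructor occurrence
    field
      points           : List Cell
      points⊆cells     : points ⊆ cells
      label            : Cell → ℕ
      label-reflects-< : ∀ {u v} → label u < label v → value u < value v
      labels           : map label points ≡ π

  contains⇒occurrence : ∀ {π} → Contains (H (3 + m)) π → Occurrence π
  contains⇒occurrence (τ , τ⊆H , refl) with ⊆-map⁻ value cells (subst (τ ⊆_) H-cells τ⊆H)
  ... | ρ , ρ⊆cells , refl =
    occurrence ρ ρ⊆cells (rank (map value ρ) ∘ value) (rank-reflects-< (map value ρ)) (map-∘ ρ)

  occurrence-⊆ : ∀ {π π′} → π′ ⊆ π → Occurrence π → Occurrence π′
  occurrence-⊆ π′⊆π (occurrence ρ ρ⊆cells g g-reflects refl) with ⊆-map⁻ g ρ π′⊆π
  ... | ρ′ , ρ′⊆ρ , refl = occurrence ρ′ (⊆-trans ρ′⊆ρ ρ⊆cells) g g-reflects refl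

  module Reflect {g : Cell → ℕ} (g-reflects : ∀ {u v} → g u < g v → value u < value v) where

    reflect-increasing : ∀ {ρ} → AllPairs _<_ (map g ρ) → AllPairs (λ u v → value u < value v) ρ
    reflect-increasing = AllPairs.map g-reflects ∘ AllPairs.map⁻

    reflect-decreasing : ∀ {ρ} → AllPairs _>_ (map g ρ) → AllPairs (λ u v → value u > value v) ρ
    reflect-decreasing = AllPairs.map g-reflects ∘ AllPairs.map⁻

    reflect-below : ∀ {ρ z} → All (_< g z) (map g ρ) → All (λ u → value u < value z) ρ
    reflect-below = All.map g-reflects ∘ All.map⁻

    reflect-above : ∀ {ρ z} → All (g z <_) (map g ρ) → All (λ u → value z < value u) ρ
    reflect-above = All.map g-reflects ∘ All.map⁻

  occurrence-decreasing⇒length≤1+m : ∀ {δ} → Occurrence δ → AllPairs _>_ δ → length δ ≤ suc m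
  occurrence-decreasing⇒length≤1+m (occurrence ρ ρ⊆cells g g-reflects refl) dec =
    subst (_≤ suc m) (sym (length-map g ρ)) (decreasing⇒length≤1+m ρ⊆cells (reflect-decreasing dec))
    where open Reflect {g} g-reflects

  increasing-below-descent⇒length≤m : ∀ {xs a b} → Occurrence (xs ++ a ∷ b ∷ []) →
    b < a → AllPairs _<_ xs → All (_< b) xs → length xs ≤ m
  increasing-below-descent⇒length≤m {xs} (occurrence ρ ρ⊆cells g g-reflects ρ↦) b<a inc below
    with map-++⁻ g xs ρ ρ↦
  ... | ρ₁ , u ∷ w ∷ [] , refl , refl , refl =
    subst (_≤ m) (sym (length-map g ρ₁)) (sameCopy-increasing⇒length≤m
      (⊆-trans (Sublist.++⁺ʳ _ ⊆-refl) ρ⊆cells)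
      (below-descent⇒firstCopy ρ⊆cells (g-reflects b<a) (reflect-below below))
      (reflect-increasing inc))
    where open Reflect {g} g-reflects

  increasing-above-descent⇒length≤m : ∀ {a b ys} → Occurrence (a ∷ b ∷ ys) →
    b < a → AllPairs _<_ ys → All (a <_) ys → length ys ≤ m
  increasing-above-descent⇒length≤m (occurrence (u ∷ w ∷ ρ) ρ⊆cells g g-reflects refl) b<a inc above =
    subst (_≤ m) (sym (length-map g ρ)) (sameCopy-increasing⇒length≤m
      (Sublist.∷ˡ⁻ (Sublist.∷ˡ⁻ ρ⊆cells))
      (above-descent⇒secondCopy ρ⊆cells (g-reflects b<a) (reflect-above above))
      (reflect-increasing inc))
    where open Reflect {g} g-reflects

  increasing-above-last⇒length≤m : ∀ {ys z} → Occurrence (ys ++ [ z ]) →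
    AllPairs _<_ ys → All (z <_) ys → length ys ≤ m
  increasing-above-last⇒length≤m {ys} (occurrence ρ ρ⊆cells g g-reflects ρ↦) inc above
    with map-++⁻ g ys ρ ρ↦
  ... | ρ₁ , w ∷ [] , refl , refl , refl =
    subst (_≤ m) (sym (length-map g ρ₁)) (sameCopy-increasing⇒length≤m
      (⊆-trans (Sublist.++⁺ʳ _ ⊆-refl) ρ⊆cells)
      (above-later⇒sameCopy ρ⊆cells (reflect-above above))
      (reflect-increasing inc))
    where open Reflect {g} g-reflects

  increasing-below-first⇒length≤m : ∀ {z ys} → Occurrence (z ∷ ys) →
    AllPairs _<_ ys → All (_< z) ys → length ys ≤ m
  increasing-below-first⇒length≤m (occurrence (w ∷ ρ) ρ⊆cells g g-reflects refl) inc below =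
    subst (_≤ m) (sym (length-map g ρ)) (sameCopy-increasing⇒length≤m
      (Sublist.∷ˡ⁻ ρ⊆cells)
      (below-earlier⇒sameCopy ρ⊆cells (reflect-below below))
      (reflect-increasing inc))
    where open Reflect {g} g-reflects

  occurrence-compl⇒length≤1+m : ∀ {σ σ′} → σ′ ⊆ σ → AllPairs _<_ σ′ → All (_≤ length σ) σ′ →
                                Occurrence (compl σ) → length σ′ ≤ suc m
  occurrence-compl⇒length≤1+m {σ} {σ′} σ′⊆σ inc bounded o =
    subst (_≤ suc m) (length-map (suc (length σ) ∸_) σ′)
      (occurrence-decreasing⇒length≤1+m (occurrence-⊆ (Sublist.map⁺ _ σ′⊆σ) o)
                                        (compl-increasing inc bounded))

  k : ℕ
  k = 3 + m

  q-tail-decreasing : AllPairs _>_ (map (k ∸_) (upTo (2 + m)))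
  q-tail-decreasing = AllPairs.map⁺ (AllPairs-zipWithAll
    (λ _ j<2+m i<j → ∸-monoʳ-< i<j (m≤n⇒m≤1+n (<⇒≤ j<2+m)))
    (All.all-upTo (2 + m)) (upTo-increasing (2 + m)))

  p-avoided : ¬ Occurrence (p k)
  p-avoided o = <⇒≱ (≤-reflexive (sym (length-map-upTo suc (suc m))))
    (increasing-below-descent⇒length≤m o (n<1+n (2 + m))
      (map-upTo-increasing (suc m) s≤s) (All.map⁺ (All.map s≤s (All.all-upTo (suc m)))))

  q-avoided : ¬ Occurrence (q k)
  q-avoided o = <⇒≱ (≤-reflexive (sym (length-map-upTo _ (2 + m))))
    (occurrence-decreasing⇒length≤1+m (occurrence-⊆ (1 ∷ʳ ⊆-refl) o) q-tail-decreasing)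

  r-avoided : ¬ Occurrence (r k)
  r-avoided o = <⇒≱ (≤-reflexive (sym (length-map-upTo _ (suc m))))
    (increasing-above-descent⇒length≤m o (n<1+n 1)
      (map-upTo-increasing (suc m) (+-monoˡ-< 3)) (All.map⁺ (All.universal (m≤n+m 3) (upTo (suc m)))))

  s-avoided : ¬ Occurrence (s k)
  s-avoided o = <⇒≱ (<-trans (n<1+n m) (≤-reflexive (sym (length-map-upTo _ (2 + m)))))
    (increasing-above-last⇒length≤m o
      (map-upTo-increasing (2 + m) (+-monoˡ-< 2)) (All.map⁺ (All.universal (m≤n+m 2) (upTo (2 + m)))))

  length-p : length (p k) ≡ k
  length-p = trans (length-++ (idP (suc m)))
    (trans (cong (_+ 2) (length-map-upTo suc (suc m))) (+-comm (suc m) 2))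

  length-q : length (q k) ≡ k
  length-q = cong suc (length-map-upTo _ (2 + m))

  length-r : length (r k) ≡ k
  length-r = cong (2 +_) (length-map-upTo _ (suc m))

  length-s : length (s k) ≡ k
  length-s = trans (length-++ (map (_+ 2) (upTo (2 + m))))
    (trans (cong (_+ 1) (length-map-upTo _ (2 + m))) (+-comm (2 + m) 1))

  compl-p-avoided : ¬ Occurrence (compl (p k))
  compl-p-avoided o =
    <⇒≱ (≤-reflexive (sym length-σ′)) (occurrence-compl⇒length≤1+m σ′⊆p increasing bounded o)
    where
    σ′ = idP (suc m) ++ [ k ]
    σ′⊆p : σ′ ⊆ p k
    σ′⊆p = Sublist.++⁺ (⊆-refl {x = idP (suc m)}) (refl ∷ (2 + m ∷ʳ []))
    increasing : AllPairs _<_ σ′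
    increasing = AllPairs.++⁺ (map-upTo-increasing (suc m) s≤s) ([] ∷ [])
      (All.map⁺ (All.map (λ i<1+m → m≤n⇒m≤1+n (s≤s i<1+m) ∷ []) (All.all-upTo (suc m))))
    bounded : All (_≤ length (p k)) σ′
    bounded = subst (λ n → All (_≤ n) σ′) (sym length-p)
      (All.++⁺ (All.map⁺ (All.map (m≤n⇒m≤1+n ∘ m≤n⇒m≤1+n) (All.all-upTo (suc m)))) (≤-refl ∷ []))
    length-σ′ : length σ′ ≡ 2 + m
    length-σ′ = trans (length-++ (idP (suc m)))
      (trans (cong (_+ 1) (length-map-upTo suc (suc m))) (+-comm (suc m) 1))

  compl-q-avoided : ¬ Occurrence (compl (q k))
  compl-q-avoided o = <⇒≱ (<-trans (n<1+n m) (≤-reflexive (sym length-ys)))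
    (increasing-below-first⇒length≤m o (compl-decreasing q-tail-decreasing bounded) (compl-above above-1 bounded))
    where
    ds = map (k ∸_) (upTo (2 + m))
    length-ys : length (map (suc (length (q k)) ∸_) ds) ≡ 2 + m
    length-ys = trans (length-map _ ds) (length-map-upTo _ (2 + m))
    bounded : All (_≤ length (q k)) ds
    bounded = subst (λ n → All (_≤ n) ds) (sym length-q) (All.map⁺ (All.universal (m∸n≤m k) (upTo (2 + m))))
    above-1 : All (1 <_) ds
    above-1 = All.map⁺ (All.map
      (λ {i} i<2+m → subst (_≤ k ∸ i) (m+n∸n≡m 2 m) (∸-monoʳ-≤ k (≤-pred i<2+m)))
      (All.all-upTo (2 + m)))

  compl-r-avoided : ¬ Occurrence (compl (r k))
  compl-r-avoided o = <⇒≱ (≤-reflexive (sym (cong suc (length-map-upTo _ (suc m)))))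
    (occurrence-compl⇒length≤1+m (2 ∷ʳ ⊆-refl) increasing bounded o)
    where
    ys = map (_+ 3) (upTo (suc m))
    increasing : AllPairs _<_ (1 ∷ ys)
    increasing = All.map⁺ (All.universal (λ i → ≤-trans (n≤1+n 2) (m≤n+m 3 i)) (upTo (suc m)))
               ∷ map-upTo-increasing (suc m) (+-monoˡ-< 3)
    bounded : All (_≤ length (r k)) (1 ∷ ys)
    bounded = subst (λ n → All (_≤ n) (1 ∷ ys)) (sym length-r) (s≤s z≤n ∷ All.map⁺ (All.map
      (λ i<1+m → ≤-trans (+-monoˡ-≤ 3 (≤-pred i<1+m)) (≤-reflexive (+-comm m 3)))
      (All.all-upTo (suc m))))

  compl-s-avoided : ¬ Occurrence (compl (s k))
  compl-s-avoided o = <⇒≱ (≤-reflexive (sym (length-map-upTo _ (2 + m))))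
    (occurrence-compl⇒length≤1+m (Sublist.++⁺ʳ [ 1 ] ⊆-refl) (map-upTo-increasing (2 + m) (+-monoˡ-< 2)) bounded o)
    where
    ys = map (_+ 2) (upTo (2 + m))
    bounded : All (_≤ length (s k)) ys
    bounded = subst (λ n → All (_≤ n) ys) (sym length-s) (All.map⁺ (All.map
      (λ i<2+m → ≤-trans (+-monoˡ-≤ 2 (≤-pred i<2+m)) (≤-reflexive (+-comm (suc m) 2)))
      (All.all-upTo (2 + m))))

  H-avoids-B : Avoids (H k) (B k)
  H-avoids-B =
    avoided p-avoided ∷ avoided q-avoided ∷ avoided r-avoided ∷ avoided s-avoided ∷
    avoided compl-p-avoided ∷ avoided compl-q-avoided ∷ avoided compl-r-avoided ∷ avoided compl-s-avoided ∷ []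
    where
    avoided : ∀ {π} → ¬ Occurrence π → ¬ Contains (H k) π
    avoided ¬occurrence = ¬occurrence ∘ contains⇒occurrence

-- The first entry of H (4 + m′) is 1 + (1 + m′)², not 1.
H≢idP : ∀ m′ n → H (4 + m′) ≢ idP (suc n)
H≢idP m′ n H≡idP with trans (sym (Cells.H-cells (suc m′))) H≡idP
... | ()

H≢reverse-idP : ∀ m′ n → H (4 + m′) ≢ reverse (idP n)
H≢reverse-idP m′ n H≡rev = <⇒≱ second<first first≤second
  where
  open Cells (suc m′)
  cells-decreasing : AllPairs (λ u v → value u > value v) cells
  cells-decreasing = AllPairs.map⁻ (subst (AllPairs _>_) (trans (sym H≡rev) H-cells) (reverse-idP-decreasing n))
  second<first : value (cell 1 (suc m′) 0) < value (cell 0 (suc m′) 0)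
  second<first = All.head (All.head (proj₂ (proj₂ (AllPairs-++⁻ (copyCells 0 (suc m′)) cells-decreasing))))
  first≤second : value (cell 0 (suc m′) 0) ≤ value (cell 1 (suc m′) 0)
  first≤second = s≤s (m≤n+m _ (1 * M))

nonMonotone-avoider⇒bound : ∀ {k n N σ} → IsPerm n σ → Avoids σ (B k) →
  σ ≢ idP n → σ ≢ reverse (idP n) → GoodBound k N → n < N
nonMonotone-avoider⇒bound {n = n} {N} σ↭ avoids ≢idP ≢reverse good with N ≤? n
... | no N≰n = ≰⇒> N≰n
... | yes N≤n = contradiction (proj₁ (good n N≤n _ σ↭) avoids) [ ≢idP , ≢reverse ]′

proposition7p5 : (k : ℕ) → 4 ≤ k →
    Avoids (H k) (B k)
    × ((N : ℕ) → GoodBound k N → 2 * (k ∸ 2) * (k ∸ 3) + 1 ≤ N)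
proposition7p5 k@(suc (suc (suc (suc m′)))) (s≤s (s≤s (s≤s (s≤s z≤n)))) = H-avoids-B , λ N good →
  subst (_≤ N) (+-comm 1 n)
    (nonMonotone-avoider⇒bound {k} (H-isPerm k) H-avoids-B (H≢idP m′ _) (H≢reverse-idP m′ n) good)
  where
  open Avoidance (suc m′) using (H-avoids-B)
  n = 2 * (k ∸ 2) * (k ∸ 3)
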